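{- There is an absolute constant $c$ such that the following holds. Let $G$ be a graph, $X\subseteq V(G)$, and $\omega\colon E(G)\to\mathbb{N}$ a weight function such that for all $\gamma\in\mathsf{conf}(X)$ we have $|\mathsf{Min}(\omega,G,\gamma)|\le 1$. Then $$\Bigl|\bigcup_{\gamma\in\mathsf{conf}(X)}\mathsf{Min}(\omega,G,\gamma)\Bigr|\le 2^{c|X|}.$$
   Context: A partial solution in $G$ is an edge set $S\subseteq E(G)$ without cycles in which every vertex is incident to at most two edges of $S$. For $X\subseteq V(G)$, $\mathsf{conf}(X)$ is the set of tuples $(V_0,V_1,V_2,M)$ where $(V_0,V_1,V_2)$ is a partition of $X$ and $M$ is a perfect matching on $V_1$ (a set of pairs of elements of $V_1$). A configuration $\gamma=(V_0,V_1,V_2,M)\in\mathsf{conf}(X)$ and a partial solution $S\subseteq E(G)$ are compliant if $S\cap M=\emptyset$ and $S\cup M$ forms a Hamiltonian cycle on the vertex set $V(G)\setminus V_2$. For $\omega\colon E(G)\to\mathbb{N}$, $\omega(S)=\sum_{e\in S}\omega(e)$, and $\mathsf{Min}(\omega,G,\gamma)$ is the set of partial solutions $S\subseteq E(G)$ compliant with $\gamma$ that have the minimum weight $\omega(S)$ among all partial solutions compliant with $\gamma$. -}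

module Defs where

open import Data.Nat using (ℕ; zero; suc; _+_; _≤_; _<_; _<?_)
open import Data.Fin using (Fin; zero; suc; toℕ; fromℕ<; _≟_)
open import Data.Fin.Subset using (Subset; _∈_; _∉_; _∩_; ∣_∣)
open import Data.Vec using (tabulate; lookup)
open import Data.Bool using (Bool; _∨_)
open import Data.Product using (Σ; ∃; ∃-syntax; _×_; _,_)
open import Data.Sum using (_⊎_)
open import Data.Empty using (⊥)
open import Relation.Nullary using (¬_; Dec; yes; no)
open import Relation.Nullary.Decidable using (⌊_⌋)
open import Relation.Binary.PropositionalEquality using (_≡_; _≢_)
open import Function.Definitions using (Injective)
open import Function.Bundles using (_⇔_)

Joins : ∀ {n} → Fin n × Fin n → Fin n → Fin n → Set
Joins (a , b) u v = (a ≡ u × b ≡ v) ⊎ (a ≡ v × b ≡ u)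

record Graph (n m : ℕ) : Set where
  field
    ends       : Fin m → Fin n × Fin n
    loopless   : ∀ e → let (a , b) = ends e in a ≢ b
    noParallel : ∀ e f → let (a , b) = ends f in Joins (ends e) a b → e ≡ f
open Graph public

EdgeSet : ℕ → Set
EdgeSet m = Subset m

incident : ∀ {n m} → Graph n m → Fin n → Subset m
incident G v = tabulate λ e → let (a , b) = ends G e in ⌊ a ≟ v ⌋ ∨ ⌊ b ≟ v ⌋

next : ∀ {k} → Fin (suc k) → Fin (suc k)
next {k} i with toℕ i <? k
... | yes p = suc (fromℕ< p)
... | no _  = zero

SEdge : ∀ {n m} → Graph n m → EdgeSet m → Fin n → Fin n → Set
SEdge G S u v = ∃[ e ] (e ∈ S × Joins (ends G e) u v)

CycleIn : ∀ {n m} → Graph n m → EdgeSet m → Set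
CycleIn G S = ∃[ k ] Σ (Fin (suc (suc (suc k))) → Fin _) λ c →
  Injective _≡_ _≡_ c × (∀ i → SEdge G S (c i) (c (next i)))

PartialSolution : ∀ {n m} → Graph n m → EdgeSet m → Set
PartialSolution G S = ¬ CycleIn G S × (∀ v → ∣ S ∩ incident G v ∣ ≤ 2)

record Conf {n : ℕ} (X : Subset n) : Set₁ where
  field
    V₀ V₁ V₂ : Subset n
    cover    : ∀ v → v ∈ X → v ∈ V₀ ⊎ v ∈ V₁ ⊎ v ∈ V₂
    V₀⊆X     : ∀ v → v ∈ V₀ → v ∈ X
    V₁⊆X     : ∀ v → v ∈ V₁ → v ∈ X
    V₂⊆X     : ∀ v → v ∈ V₂ → v ∈ X
    disj₀₁   : ∀ v → v ∈ V₀ → v ∉ V₁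
    disj₀₂   : ∀ v → v ∈ V₀ → v ∉ V₂
    disj₁₂   : ∀ v → v ∈ V₁ → v ∉ V₂
    M        : Fin n → Fin n → Set
    M-sym    : ∀ u v → M u v → M v u
    M-irrefl : ∀ v → ¬ M v v
    M-dom    : ∀ u v → M u v → u ∈ V₁
    M-perf   : ∀ u → u ∈ V₁ → ∃[ v ] (M u v × (∀ w → M u w → w ≡ v))
open Conf public

HamCycleOn : ∀ {n} → (Fin n → Fin n → Set) → (Fin n → Set) → Set
HamCycleOn {n} E U = ∃[ k ] Σ (Fin (suc (suc (suc k))) → Fin n) λ c →
  Injective _≡_ _≡_ c
  × (∀ v → U v ⇔ (∃[ i ] c i ≡ v))
  × (∀ u v → E u v ⇔ (∃[ i ] Joins (c i , c (next i)) u v))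

Compliant : ∀ {n m} → Graph n m → {X : Subset n} → Conf X → EdgeSet m → Set
Compliant G γ S =
  (∀ e → e ∈ S → let (a , b) = ends G e in ¬ M γ a b)
  × HamCycleOn (λ u v → SEdge G S u v ⊎ M γ u v) (λ v → v ∉ V₂ γ)

weight : ∀ {m} → (Fin m → ℕ) → EdgeSet m → ℕ
weight {zero}  ω S = 0
weight {suc m} ω S = (if lookup S zero then ω zero else 0)
                   + weight (λ e → ω (suc e)) (Data.Vec.tail S)
  where open import Data.Bool using (if_then_else_)

InMin : ∀ {n m} → (Fin m → ℕ) → Graph n m → {X : Subset n} → Conf X → EdgeSet m → Set
InMin ω G γ S =
  (PartialSolution G S × Compliant G γ S)
  × (∀ S' → PartialSolution G S' → Compliant G γ S' → weight ω S ≤ weight ω S')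

module Submission where

-- Fix an anchor a ∈ V₁ on the Hamiltonian cycle S ∪ M of a compliant pair (S, γ). Over GF(2), indexed by
-- triples (A, B, L) of subsets of X, let u_S record [A = V₁] [B = V₂] [a ∉ L and L is the trace on V₁ of
-- a cut of V(G) that no edge of S crosses], and w_γ′ record [A = V₁′] [B = V₂′] [L is constant on the
-- pairs of M′]. If V₁′ = V₁ and V₂′ = V₂, then ⟨u_S, w_γ′⟩ is the parity of the number of unions of
-- components of S ∪ M′ avoiding a, restricted to V₁. It is 1 for γ′ = γ; and when it is 1, no component
-- other than that of a meets V₁, while a component missing V₁ is closed along the cycle S ∪ M and so
-- contains a: S ∪ M′ is connected and two-regular, so S is compliant with γ′. Listing the solutions by
-- weight, uniqueness of the minima makes (⟨u_S, w_γ_T⟩) unit lower triangular, so the u_S are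
-- independent and there are at most 2^(3|X|) of them.

open import Defs
open import Data.Bool using (Bool; true; false; not; _∧_; _∨_; _xor_)
open import Data.Bool.Properties
  using (xor-assoc; xor-comm; xor-identityʳ; xor-same; xor-∧-commutativeRing; not-injective;
         ∧-assoc; ∧-identityʳ; ∧-zeroʳ; ∧-distribˡ-xor; ∧-distribʳ-xor)
  renaming (_≟_ to _≟ᵇ_)
open import Data.Nat using (ℕ; zero; suc; _+_; _*_; _^_; _<_; _≤_; z≤n; s≤s; _<?_)
open import Data.Nat.Properties
  using (<-irrefl; <-cmp; <-trans; ≤-refl; ≤-reflexive; ≤-trans; n<1+n; suc-injective; m≢1+n+m; +-identityʳ;
         ^-distribˡ-+-*; anyUpTo?; ≤-decTotalOrder; module ≤-Reasoning)
open import Data.Nat.Induction using (<-rec)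
open import Data.Fin using (Fin; zero; suc; toℕ; fromℕ; inject₁) renaming (_≟_ to _≟ᶠ_)
open import Data.Fin.Properties
  using (toℕ-injective; toℕ-fromℕ; toℕ-fromℕ<; toℕ-inject₁; toℕ<n; pigeonhole; any?; all?)
open import Data.Fin.Induction using (<-weakInduction; >-weakInduction)
open import Data.Fin.Subset using (Subset; outside; inside; _∈_; _∉_; _⊆_; ∣_∣) renaming (⊥ to ∅)
open import Data.Fin.Subset.Properties using (_∈?_; drop-∷-⊆; anySubset?; ⊥⊆)
open import Data.Vec using ([]; _∷_; lookup; tabulate; zipWith; here; there)
open import Data.Vec.Properties
  using (∷-injectiveʳ; ≡-dec; lookup-zipWith; lookup-replicate; lookup∘tabulate; tabulate∘lookup; tabulate-cong;
         []=⇒lookup; lookup⇒[]=)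
open import Data.List using (List; []; _∷_; [_]; _++_; map; length; cartesianProduct)
open import Data.List.Properties using (length-++; length-map)
open import Data.List.Relation.Unary.All as All using (All; []; _∷_)
import Data.List.Relation.Unary.All.Properties as All
open import Data.List.Relation.Unary.AllPairs as AllPairs using (AllPairs; []; _∷_)
import Data.List.Relation.Unary.AllPairs.Properties as AllPairs
open import Data.List.Relation.Unary.Unique.Propositional using (Unique)
open import Data.List.Relation.Binary.Permutation.Propositional using (↭-sym; ↭⇒↭ₛ)
open import Data.List.Relation.Binary.Permutation.Propositional.Properties using (↭-length) renaming (map⁺ to ↭-map⁺)
import Data.List.Relation.Binary.Permutation.Setoid.Properties as Permutationₛ
open import Data.List.Relation.Unary.Sorted.TotalOrder.Properties using (Sorted⇒AllPairs)
import Data.List.Sort as Sort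
open import Data.Product using (Σ; Σ-syntax; ∃; ∃-syntax; _×_; _,_; proj₁; proj₂)
open import Data.Sum as Sum using (_⊎_; inj₁; inj₂)
open import Data.Empty using (⊥; ⊥-elim)
open import Function using (_∘_)
open import Function.Bundles using (Equivalence; mk⇔)
open import Function.Definitions using (Injective)
open import Relation.Binary using (tri<; tri≈; tri>)
open import Relation.Binary.Bundles using (DecTotalOrder)
import Relation.Binary.Construct.On as On
open import Algebra.Bundles using (CommutativeRing)
open import Algebra.Properties.CommutativeSemigroup (CommutativeRing.+-commutativeSemigroup xor-∧-commutativeRing)
  using () renaming (interchange to xor-interchange)
open import Relation.Binary.PropositionalEquality
  using (_≡_; _≢_; refl; sym; trans; cong; cong₂; subst; setoid; module ≡-Reasoning)
open import Relation.Nullary using (¬_; Dec; does; yes; no; contradiction)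
open import Relation.Nullary.Decidable using (dec-true; dec-false; decidable-stable; _×-dec_; _→-dec_)
open import Relation.Unary using (Decidable)

next-fromℕ : ∀ m → next (fromℕ m) ≡ zero
next-fromℕ m with toℕ (fromℕ m) <? m
... | yes m<m = ⊥-elim (<-irrefl (toℕ-fromℕ m) m<m)
... | no _ = refl

next-inject₁ : ∀ {m} (j : Fin m) → next (inject₁ j) ≡ suc j
next-inject₁ {m} j with toℕ (inject₁ j) <? m
... | yes p = cong suc (toℕ-injective (trans (toℕ-fromℕ< p) (toℕ-inject₁ j)))
... | no ¬p = ⊥-elim (¬p (subst (λ t → suc t ≤ m) (sym (toℕ-inject₁ j)) (toℕ<n j)))

data LastOrInject₁ : ∀ {m} → Fin (suc m) → Set where
  last    : ∀ {m} → LastOrInject₁ (fromℕ m)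
  inject  : ∀ {m} (j : Fin m) → LastOrInject₁ (inject₁ j)

lastOrInject₁ : ∀ {m} (i : Fin (suc m)) → LastOrInject₁ i
lastOrInject₁ {zero} zero = last
lastOrInject₁ {suc m} zero = inject zero
lastOrInject₁ {suc m} (suc i) with lastOrInject₁ i
... | last = last
... | inject j = inject (suc j)

prev : ∀ {m} → Fin (suc m) → Fin (suc m)
prev {m} zero = fromℕ m
prev (suc j) = inject₁ j

next-prev : ∀ {m} (i : Fin (suc m)) → next (prev i) ≡ i
next-prev {m} zero = next-fromℕ m
next-prev (suc j) = next-inject₁ j

prev-next : ∀ {m} (i : Fin (suc m)) → prev (next i) ≡ i
prev-next i with lastOrInject₁ i
... | last {m} rewrite next-fromℕ m = refl
... | inject j rewrite next-inject₁ j = refl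

prev≢next : ∀ {k} (i : Fin (suc (suc (suc k)))) → prev i ≢ next i
prev≢next i with lastOrInject₁ i
... | last {m} rewrite next-fromℕ m = λ ()
... | inject j rewrite next-inject₁ j = prev-inject₁≢suc j
  where
  prev-inject₁≢suc : ∀ {k} (j : Fin (suc (suc k))) → prev (inject₁ j) ≢ suc j
  prev-inject₁≢suc zero = λ ()
  prev-inject₁≢suc (suc j) eq = m≢1+n+m (toℕ j) (begin
    toℕ j                       ≡⟨ toℕ-inject₁ j ⟨
    toℕ (inject₁ j)             ≡⟨ toℕ-inject₁ (inject₁ j) ⟨
    toℕ (inject₁ (inject₁ j))   ≡⟨ cong toℕ eq ⟩
    suc (suc (toℕ j))           ∎)
    where open ≡-Reasoning

module _ {m} (P : Fin (suc m) → Set) (closed : ∀ i → P i → P (next i)) where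

  next-closed⇒universal : ∀ {i} → P i → ∀ j → P j
  next-closed⇒universal {i} Pi = <-weakInduction P P₀ (λ j Pj → subst P (next-inject₁ j) (closed _ Pj))
    where
    reaches-last : ∀ i → P i → P (fromℕ m)
    reaches-last = >-weakInduction (λ i → P i → P (fromℕ m)) (λ Pi → Pi)
                    (λ j h Pj → h (subst P (next-inject₁ j) (closed _ Pj)))
    P₀ : P zero
    P₀ = subst P (next-fromℕ m) (closed _ (reaches-last i Pi))

witness : ∀ {P : Set} (P? : Dec P) → does P? ≡ true → P
witness (yes p) _ = p

∧-false : ∀ {b c} → (b ≡ true → c ≡ true → ⊥) → b ∧ c ≡ false
∧-false {false}          _   = refl
∧-false {true} {false}   _   = refl
∧-false {true} {true}  ¬b∧c = ⊥-elim (¬b∧c refl refl)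

does-cong : ∀ {P Q : Set} (P? : Dec P) (Q? : Dec Q) → (P → Q) → (Q → P) → does P? ≡ does Q?
does-cong (yes p) Q? P⇒Q _   = sym (dec-true Q? (P⇒Q p))
does-cong (no ¬p) Q? _   Q⇒P = sym (dec-false Q? (λ q → ¬p (Q⇒P q)))

parity : ∀ {A : Set} → List A → (A → Bool) → Bool
parity []       f = false
parity (x ∷ xs) f = f x xor parity xs f

module _ {A : Set} where

  parity-cong : ∀ (xs : List A) {f g : A → Bool} → (∀ a → f a ≡ g a) → parity xs f ≡ parity xs g
  parity-cong []       f≗g = refl
  parity-cong (x ∷ xs) f≗g = cong₂ _xor_ (f≗g x) (parity-cong xs f≗g)

  parity-false : ∀ (xs : List A) {f : A → Bool} → (∀ a → f a ≡ false) → parity xs f ≡ false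
  parity-false []       f≗0 = refl
  parity-false (x ∷ xs) f≗0 rewrite f≗0 x = parity-false xs f≗0

  parity-xor : ∀ (xs : List A) f g → parity xs (λ a → f a xor g a) ≡ parity xs f xor parity xs g
  parity-xor []       f g = refl
  parity-xor (x ∷ xs) f g rewrite parity-xor xs f g = xor-interchange (f x) (g x) (parity xs f) (parity xs g)

  parity-++ : ∀ (xs ys : List A) f → parity (xs ++ ys) f ≡ parity xs f xor parity ys f
  parity-++ []       ys f = refl
  parity-++ (x ∷ xs) ys f rewrite parity-++ xs ys f = sym (xor-assoc (f x) (parity xs f) (parity ys f))

  parity-map : ∀ {B : Set} (h : B → A) (xs : List B) f → parity (map h xs) f ≡ parity xs (λ b → f (h b))
  parity-map h []       f = refl
  parity-map h (x ∷ xs) f = cong (f (h x) xor_) (parity-map h xs f)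

subsets : ∀ {n} → Subset n → List (Subset n)
subsets []            = [ [] ]
subsets (outside ∷ X) = map (outside ∷_) (subsets X)
subsets (inside ∷ X)  = map (outside ∷_) (subsets X) ++ map (inside ∷_) (subsets X)

length-subsets : ∀ {n} (X : Subset n) → length (subsets X) ≡ 2 ^ ∣ X ∣
length-subsets []            = refl
length-subsets (outside ∷ X) = trans (length-map (outside ∷_) (subsets X)) (length-subsets X)
length-subsets (inside ∷ X)  = begin
  length (map (outside ∷_) (subsets X) ++ map (inside ∷_) (subsets X))
    ≡⟨ length-++ (map (outside ∷_) (subsets X)) ⟩
  length (map (outside ∷_) (subsets X)) + length (map (inside ∷_) (subsets X))
    ≡⟨ cong₂ _+_ (length-map _ (subsets X)) (length-map _ (subsets X)) ⟩
  length (subsets X) + length (subsets X)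
    ≡⟨ cong₂ _+_ (length-subsets X) (trans (length-subsets X) (sym (+-identityʳ _))) ⟩
  2 ^ ∣ X ∣ + (2 ^ ∣ X ∣ + 0) ∎
  where open ≡-Reasoning

module _ {n} (X : Subset n) (f : Subset (suc n) → Bool) where

  parity-subsets-outside : parity (subsets (outside ∷ X)) f ≡ parity (subsets X) (λ A → f (outside ∷ A))
  parity-subsets-outside = parity-map (outside ∷_) (subsets X) f

  parity-subsets-inside : parity (subsets (inside ∷ X)) f ≡
                          parity (subsets X) (λ A → f (outside ∷ A)) xor parity (subsets X) (λ A → f (inside ∷ A))
  parity-subsets-inside = trans (parity-++ (map (outside ∷_) (subsets X)) _ f)
                                (cong₂ _xor_ (parity-map (outside ∷_) (subsets X) f) (parity-map (inside ∷_) (subsets X) f))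

_⊕_ : ∀ {n} → Subset n → Subset n → Subset n
_⊕_ = zipWith _xor_

lookup-⊕ : ∀ {n} (l l′ : Subset n) x → lookup (l ⊕ l′) x ≡ lookup l x xor lookup l′ x
lookup-⊕ l l′ x = lookup-zipWith _xor_ x l l′

⊕-cancelʳ : ∀ {n} (l l′ : Subset n) → (l ⊕ l′) ⊕ l′ ≡ l
⊕-cancelʳ []      []        = refl
⊕-cancelʳ (b ∷ l) (b′ ∷ l′) =
  cong₂ _∷_ (trans (xor-assoc b b′ b′) (trans (cong (b xor_) (xor-same b′)) (xor-identityʳ b))) (⊕-cancelʳ l l′)

does-invariant-⊕ : ∀ {n} {P : Subset n → Set} (P? : ∀ l → Dec (P l)) l′ → (∀ {l} → P l → P (l ⊕ l′)) →
                   ∀ l → does (P? (l ⊕ l′)) ≡ does (P? l)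
does-invariant-⊕ {P = P} P? l′ closed l =
  does-cong (P? (l ⊕ l′)) (P? l) (λ p → subst P (⊕-cancelʳ l l′) (closed p)) closed

parity-point : ∀ {n} {X T : Subset n} (f : Subset n → Bool) → T ⊆ X →
               (∀ A → A ≢ T → f A ≡ false) → parity (subsets X) f ≡ f T
parity-point {X = []}          {[]}          f _   _  = xor-identityʳ (f [])
parity-point {X = outside ∷ X} {inside ∷ T}  f T⊆X _  with () ← T⊆X here
parity-point {X = outside ∷ X} {outside ∷ T} f T⊆X f0 =
  trans (parity-subsets-outside X f) (parity-point _ (drop-∷-⊆ T⊆X) (λ A A≢T → f0 _ (A≢T ∘ ∷-injectiveʳ)))
parity-point {X = inside ∷ X}  {outside ∷ T} f T⊆X f0 = begin
  parity (subsets (inside ∷ X)) f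
    ≡⟨ parity-subsets-inside X f ⟩
  parity (subsets X) (λ A → f (outside ∷ A)) xor parity (subsets X) (λ A → f (inside ∷ A))
    ≡⟨ cong₂ _xor_ (parity-point _ (drop-∷-⊆ T⊆X) (λ A A≢T → f0 _ (A≢T ∘ ∷-injectiveʳ)))
                   (parity-false (subsets X) (λ A → f0 _ λ ())) ⟩
  f (outside ∷ T) xor false
    ≡⟨ xor-identityʳ _ ⟩
  f (outside ∷ T) ∎
  where open ≡-Reasoning
parity-point {X = inside ∷ X}  {inside ∷ T}  f T⊆X f0 = begin
  parity (subsets (inside ∷ X)) f
    ≡⟨ parity-subsets-inside X f ⟩
  parity (subsets X) (λ A → f (outside ∷ A)) xor parity (subsets X) (λ A → f (inside ∷ A))
    ≡⟨ cong₂ _xor_ (parity-false (subsets X) (λ A → f0 _ λ ()))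
                   (parity-point _ (drop-∷-⊆ T⊆X) (λ A A≢T → f0 _ (A≢T ∘ ∷-injectiveʳ))) ⟩
  false xor f (inside ∷ T) ∎
  where open ≡-Reasoning

parity-shift : ∀ {n} {X C : Subset n} (f : Subset n → Bool) → C ⊆ X →
               parity (subsets X) (λ A → f (A ⊕ C)) ≡ parity (subsets X) f
parity-shift {X = []}          {[]}          f _   = refl
parity-shift {X = outside ∷ X} {inside ∷ C}  f C⊆X with () ← C⊆X here
parity-shift {X = outside ∷ X} {outside ∷ C} f C⊆X =
  trans (parity-subsets-outside X _)
        (trans (parity-shift (λ A → f (outside ∷ A)) (drop-∷-⊆ C⊆X)) (sym (parity-subsets-outside X f)))
parity-shift {X = inside ∷ X}  {outside ∷ C} f C⊆X =
  trans (parity-subsets-inside X _)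
        (trans (cong₂ _xor_ (parity-shift (λ A → f (outside ∷ A)) (drop-∷-⊆ C⊆X))
                            (parity-shift (λ A → f (inside ∷ A)) (drop-∷-⊆ C⊆X)))
               (sym (parity-subsets-inside X f)))
parity-shift {X = inside ∷ X}  {inside ∷ C}  f C⊆X =
  trans (parity-subsets-inside X _)
        (trans (cong₂ _xor_ (parity-shift (λ A → f (inside ∷ A)) (drop-∷-⊆ C⊆X))
                            (parity-shift (λ A → f (outside ∷ A)) (drop-∷-⊆ C⊆X)))
               (trans (xor-comm (parity (subsets X) (λ A → f (inside ∷ A))) _) (sym (parity-subsets-inside X f))))

parity-involution : ∀ {n} {X C : Subset n} {i} (f : Subset n → Bool) → C ⊆ X → i ∈ C →
                    (∀ A → f (A ⊕ C) ≡ f A) → parity (subsets X) f ≡ false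
parity-involution {X = outside ∷ X} {inside ∷ C} f C⊆X _ _ with () ← C⊆X here
parity-involution {X = inside ∷ X} {inside ∷ C} f C⊆X _ f∘⊕C≗f = begin
  parity (subsets (inside ∷ X)) f
    ≡⟨ parity-subsets-inside X f ⟩
  parity (subsets X) (λ A → f (outside ∷ A)) xor parity (subsets X) (λ A → f (inside ∷ A))
    ≡⟨ cong (_xor parity (subsets X) (λ A → f (inside ∷ A))) (begin
         parity (subsets X) (λ A → f (outside ∷ A))
           ≡⟨ parity-cong (subsets X) (λ A → f∘⊕C≗f (outside ∷ A)) ⟨
         parity (subsets X) (λ A → f (inside ∷ (A ⊕ C)))
           ≡⟨ parity-shift (λ A → f (inside ∷ A)) (drop-∷-⊆ C⊆X) ⟩
         parity (subsets X) (λ A → f (inside ∷ A)) ∎) ⟩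
  parity (subsets X) (λ A → f (inside ∷ A)) xor parity (subsets X) (λ A → f (inside ∷ A))
    ≡⟨ xor-same (parity (subsets X) (λ A → f (inside ∷ A))) ⟩
  false ∎
  where open ≡-Reasoning
parity-involution {X = outside ∷ X} {outside ∷ C} f C⊆X (there i∈C) f∘⊕C≗f =
  trans (parity-subsets-outside X f)
        (parity-involution (λ A → f (outside ∷ A)) (drop-∷-⊆ C⊆X) i∈C (λ A → f∘⊕C≗f (outside ∷ A)))
parity-involution {X = inside ∷ X}  {outside ∷ C} f C⊆X (there i∈C) f∘⊕C≗f =
  trans (parity-subsets-inside X f)
        (cong₂ _xor_
          (parity-involution (λ A → f (outside ∷ A)) (drop-∷-⊆ C⊆X) i∈C (λ A → f∘⊕C≗f (outside ∷ A)))
          (parity-involution (λ A → f (inside ∷ A)) (drop-∷-⊆ C⊆X) i∈C (λ A → f∘⊕C≗f (inside ∷ A))))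

-- Unit lower triangular systems over GF(2)

module _ {C : Set} where

  inner : List C → (C → Bool) → (C → Bool) → Bool
  inner cs u w = parity cs (λ x → u x ∧ w x)

  inner-xorˡ : ∀ cs u u′ w → inner cs (λ x → u x xor u′ x) w ≡ inner cs u w xor inner cs u′ w
  inner-xorˡ cs u u′ w = trans (parity-cong cs (λ x → ∧-distribʳ-xor (w x) (u x) (u′ x)))
                               (parity-xor cs (λ x → u x ∧ w x) (λ x → u′ x ∧ w x))

  Row : Set
  Row = (C → Bool) × (C → Bool)

  UnitDiagonal : List C → Row → Set
  UnitDiagonal cs (u , w) = inner cs u w ≡ true

  ZeroAbove : List C → Row → Row → Set
  ZeroAbove cs (u , _) (_ , w′) = inner cs u w′ ≡ false

  -- Pivoting on a row p with u_p ξ = 1 clears coordinate ξ from the later rows q, and leaves their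
  -- inner products unchanged since ⟨u_p, w_q⟩ = 0.
  clear : C → Row → Row → Row
  clear ξ (u , _) (u′ , w′) = (λ x → u′ x xor (u′ ξ ∧ u x)) , w′

  clear-coordinate : ∀ ξ p q → proj₁ p ξ ≡ true → proj₁ (clear ξ p q) ξ ≡ false
  clear-coordinate ξ (u , _) (u′ , _) uξ rewrite uξ | ∧-identityʳ (u′ ξ) = xor-same (u′ ξ)

  inner-clear : ∀ cs ξ p q w → inner cs (proj₁ p) w ≡ false →
                inner cs (proj₁ (clear ξ p q)) w ≡ inner cs (proj₁ q) w
  inner-clear cs ξ (u , _) (u′ , _) w ⟨u,w⟩≡0 =
    trans (inner-xorˡ cs u′ (λ x → u′ ξ ∧ u x) w)
          (trans (cong (inner cs u′ w xor_) (scaled (u′ ξ))) (xor-identityʳ _))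
    where
    scaled : ∀ b → inner cs (λ x → b ∧ u x) w ≡ false
    scaled true  = ⟨u,w⟩≡0
    scaled false = parity-false cs (λ _ → refl)

  eliminate : C → List Row → List Row
  eliminate ξ []      = []
  eliminate ξ (p ∷ F) with proj₁ p ξ
  ... | true  = map (clear ξ p) F
  ... | false = p ∷ eliminate ξ F

  length-eliminate : ∀ ξ F → length F ≤ suc (length (eliminate ξ F))
  length-eliminate ξ []      = z≤n
  length-eliminate ξ (p ∷ F) with proj₁ p ξ
  ... | true  = s≤s (≤-reflexive (sym (length-map (clear ξ p) F)))
  ... | false = s≤s (length-eliminate ξ F)

  eliminate-clears : ∀ ξ F → All (λ q → proj₁ q ξ ≡ false) (eliminate ξ F)
  eliminate-clears ξ []      = []
  eliminate-clears ξ (p ∷ F) with proj₁ p ξ in pξ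
  ... | true  = All.map⁺ (All.universal (λ q → clear-coordinate ξ p q pξ) F)
  ... | false = pξ ∷ eliminate-clears ξ F

  eliminate-keeps-right : ∀ (P : (C → Bool) → Set) ξ F →
                          All (λ q → P (proj₂ q)) F → All (λ q → P (proj₂ q)) (eliminate ξ F)
  eliminate-keeps-right P ξ []      []         = []
  eliminate-keeps-right P ξ (p ∷ F) (Pp ∷ PF) with proj₁ p ξ
  ... | true  = All.map⁺ PF
  ... | false = Pp ∷ eliminate-keeps-right P ξ F PF

  eliminate-unitDiagonal : ∀ cs ξ F → All (UnitDiagonal cs) F → AllPairs (ZeroAbove cs) F →
                           All (UnitDiagonal cs) (eliminate ξ F)
  eliminate-unitDiagonal cs ξ []      []        []        = []
  eliminate-unitDiagonal cs ξ (p ∷ F) (Dp ∷ DF) (Zp ∷ ZF) with proj₁ p ξ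
  ... | true  = All.map⁺ (All.zipWith (λ {q} (Dq , Zpq) → trans (inner-clear cs ξ p q (proj₂ q) Zpq) Dq) (DF , Zp))
  ... | false = Dp ∷ eliminate-unitDiagonal cs ξ F DF ZF

  eliminate-zeroAbove : ∀ cs ξ F → AllPairs (ZeroAbove cs) F → AllPairs (ZeroAbove cs) (eliminate ξ F)
  eliminate-zeroAbove cs ξ []      []        = []
  eliminate-zeroAbove cs ξ (p ∷ F) (Zp ∷ ZF) with proj₁ p ξ
  ... | true  = AllPairs.map⁺ (cleared F Zp ZF)
    where
    cleared : ∀ G → All (ZeroAbove cs p) G → AllPairs (ZeroAbove cs) G →
              AllPairs (λ q r → ZeroAbove cs (clear ξ p q) (clear ξ p r)) G
    cleared []      []          []        = []
    cleared (q ∷ G) (_ ∷ ZpG) (Zq ∷ ZG) =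
      All.zipWith (λ {r} (Zqr , Zpr) → trans (inner-clear cs ξ p q (proj₂ r) Zpr) Zqr) (Zq , ZpG) ∷ cleared G ZpG ZG
  ... | false = eliminate-keeps-right (λ w → inner cs (proj₁ p) w ≡ false) ξ F Zp ∷ eliminate-zeroAbove cs ξ F ZF

  inner-drop : ∀ cs ξ u w → u ξ ≡ false → inner (ξ ∷ cs) u w ≡ inner cs u w
  inner-drop cs ξ u w uξ rewrite uξ = refl

  unitLowerTriangular⇒length≤ : ∀ cs F → All (UnitDiagonal cs) F → AllPairs (ZeroAbove cs) F →
                                length F ≤ length cs
  unitLowerTriangular⇒length≤ []       []      _        _  = z≤n
  unitLowerTriangular⇒length≤ []       (p ∷ F) (() ∷ _) _
  unitLowerTriangular⇒length≤ (ξ ∷ cs) F       DF       ZF =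
    ≤-trans (length-eliminate ξ F) (s≤s (unitLowerTriangular⇒length≤ cs (eliminate ξ F) DF′ (dropped _ clears ZF′)))
    where
    clears = eliminate-clears ξ F
    ZF′ = eliminate-zeroAbove (ξ ∷ cs) ξ F ZF
    DF′ = All.zipWith (λ {q} (qξ , Dq) → trans (sym (inner-drop cs ξ (proj₁ q) (proj₂ q) qξ)) Dq)
                      (clears , eliminate-unitDiagonal (ξ ∷ cs) ξ F DF ZF)
    dropped : ∀ G → All (λ q → proj₁ q ξ ≡ false) G → AllPairs (ZeroAbove (ξ ∷ cs)) G →
              AllPairs (ZeroAbove cs) G
    dropped []      []        []        = []
    dropped (q ∷ G) (qξ ∷ Gξ) (Zq ∷ ZG) =
      All.map (λ {r} Zqr → trans (sym (inner-drop cs ξ (proj₁ q) (proj₂ r) qξ)) Zqr) Zq ∷ dropped G Gξ ZG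

module _ {A B : Set} where

  length-cartesianProduct : ∀ (xs : List A) (ys : List B) → length (cartesianProduct xs ys) ≡ length xs * length ys
  length-cartesianProduct []       ys = refl
  length-cartesianProduct (x ∷ xs) ys = trans (length-++ (map (x ,_) ys))
                                          (cong₂ _+_ (length-map (x ,_) ys) (length-cartesianProduct xs ys))

  parity-cartesianProduct : ∀ (xs : List A) (ys : List B) f →
                            parity (cartesianProduct xs ys) f ≡ parity xs (λ x → parity ys (λ y → f (x , y)))
  parity-cartesianProduct []       ys f = refl
  parity-cartesianProduct (x ∷ xs) ys f = trans (parity-++ (map (x ,_) ys) _ f)
                                            (cong₂ _xor_ (parity-map (x ,_) ys f) (parity-cartesianProduct xs ys f))

parity-∧ˡ : ∀ {A : Set} (xs : List A) b f → parity xs (λ x → b ∧ f x) ≡ b ∧ parity xs f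
parity-∧ˡ []       b f = sym (∧-zeroʳ b)
parity-∧ˡ (x ∷ xs) b f =
  trans (cong ((b ∧ f x) xor_) (parity-∧ˡ xs b f)) (sym (∧-distribˡ-xor b (f x) (parity xs f)))

Coordinate : ℕ → Set
Coordinate n = Subset n × Subset n × Subset n

coordinates : ∀ {n} → Subset n → List (Coordinate n)
coordinates X = cartesianProduct (subsets X) (cartesianProduct (subsets X) (subsets X))

length-coordinates : ∀ {n} (X : Subset n) → length (coordinates X) ≡ 2 ^ (3 * ∣ X ∣)
length-coordinates X = begin
  length (coordinates X)
    ≡⟨ length-cartesianProduct (subsets X) _ ⟩
  length (subsets X) * length (cartesianProduct (subsets X) (subsets X))
    ≡⟨ cong (length (subsets X) *_) (length-cartesianProduct (subsets X) (subsets X)) ⟩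
  length (subsets X) * (length (subsets X) * length (subsets X))
    ≡⟨ cong (λ N → N * (N * N)) (length-subsets X) ⟩
  2 ^ ∣ X ∣ * (2 ^ ∣ X ∣ * 2 ^ ∣ X ∣)
    ≡⟨ cong (2 ^ ∣ X ∣ *_) (^-distribˡ-+-* 2 ∣ X ∣ ∣ X ∣) ⟨
  2 ^ ∣ X ∣ * 2 ^ (∣ X ∣ + ∣ X ∣)
    ≡⟨ cong (λ t → 2 ^ ∣ X ∣ * 2 ^ (∣ X ∣ + t)) (+-identityʳ ∣ X ∣) ⟨
  2 ^ ∣ X ∣ * 2 ^ (2 * ∣ X ∣)
    ≡⟨ ^-distribˡ-+-* 2 ∣ X ∣ (2 * ∣ X ∣) ⟨
  2 ^ (3 * ∣ X ∣) ∎
  where open ≡-Reasoning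

_≟ˢ_ : ∀ {n} (V W : Subset n) → Dec (V ≡ W)
_≟ˢ_ = ≡-dec _≟ᵇ_

tagged : ∀ {n} → Subset n → Subset n → (Subset n → Bool) → Coordinate n → Bool
tagged V W f (A , B , l) = does ((A ≟ˢ V) ×-dec (B ≟ˢ W)) ∧ f l

inner-tagged : ∀ {n} {X V W : Subset n} V′ W′ (f g : Subset n → Bool) → V ⊆ X → W ⊆ X →
               inner (coordinates X) (tagged V′ W′ f) (tagged V W g) ≡
               does ((V ≟ˢ V′) ×-dec (W ≟ˢ W′)) ∧ parity (subsets X) (λ l → f l ∧ g l)
inner-tagged {X = X} {V} {W} V′ W′ f g V⊆X W⊆X = begin
  parity (coordinates X) h
    ≡⟨ parity-cartesianProduct (subsets X) _ h ⟩
  parity (subsets X) (λ A → parity (cartesianProduct (subsets X) (subsets X)) (λ p → h (A , p)))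
    ≡⟨ parity-cong (subsets X) (λ A → parity-cartesianProduct (subsets X) (subsets X) (λ p → h (A , p))) ⟩
  parity (subsets X) (λ A → parity (subsets X) (λ B → parity (subsets X) (λ l → h (A , B , l))))
    ≡⟨ parity-point _ V⊆X (λ A A≢V → parity-false (subsets X) (λ B → parity-false (subsets X) (off-V A≢V B))) ⟩
  parity (subsets X) (λ B → parity (subsets X) (λ l → h (V , B , l)))
    ≡⟨ parity-point _ W⊆X (λ B B≢W → parity-false (subsets X) (off-W B≢W)) ⟩
  parity (subsets X) (λ l → h (V , W , l))
    ≡⟨ parity-cong (subsets X) (λ l → tags-match l) ⟩
  parity (subsets X) (λ l → d ∧ (f l ∧ g l))
    ≡⟨ parity-∧ˡ (subsets X) d (λ l → f l ∧ g l) ⟩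
  d ∧ parity (subsets X) (λ l → f l ∧ g l) ∎
  where
  open ≡-Reasoning
  h : Coordinate _ → Bool
  h x = tagged V′ W′ f x ∧ tagged V W g x
  d : Bool
  d = does ((V ≟ˢ V′) ×-dec (W ≟ˢ W′))
  off-V : ∀ {A} → A ≢ V → ∀ B l → h (A , B , l) ≡ false
  off-V {A} A≢V B l rewrite dec-false (A ≟ˢ V) A≢V = ∧-zeroʳ _
  off-W : ∀ {B} → B ≢ W → ∀ l → h (V , B , l) ≡ false
  off-W {B} B≢W l rewrite dec-true (V ≟ˢ V) refl | dec-false (B ≟ˢ W) B≢W = ∧-zeroʳ _
  tags-match : ∀ l → h (V , W , l) ≡ d ∧ (f l ∧ g l)
  tags-match l rewrite dec-true (V ≟ˢ V) refl | dec-true (W ≟ˢ W) refl = ∧-assoc d (f l) (g l)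

-- Connected two-regular relations are Hamiltonian cycles

Least : (ℕ → Set) → ℕ → Set
Least P m = P m × (∀ s → s < m → ¬ P s)

minimal-witness : ∀ {P : ℕ → Set} → Decidable P → ∀ t → P t → ∃[ m ] Least P m
minimal-witness {P} P? = <-rec (λ t → P t → ∃[ m ] Least P m) search
  where
  search : ∀ t → (∀ {s} → s < t → P s → ∃[ m ] Least P m) → P t → ∃[ m ] Least P m
  search t rec Pt with anyUpTo? P? t
  ... | yes (s , s<t , Ps) = rec s<t Ps
  ... | no ¬earlier = t , Pt , λ s s<t Ps → ¬earlier (s , s<t , Ps)

TwoNeighbours : ∀ {n} → (Fin n → Fin n → Set) → Fin n → Set
TwoNeighbours {n} E x = Σ (Fin n × Fin n) λ (y , z) → y ≢ z × E x y × E x z × (∀ {v} → E x v → v ≡ y ⊎ v ≡ z)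

module TwoRegular {n} (E : Fin n → Fin n → Set) (U : Fin n → Set)
  (E-sym : ∀ {x y} → E x y → E y x) (E-irrefl : ∀ {x} → ¬ E x x) (E⇒U : ∀ {x y} → E x y → U x)
  (degree-two : ∀ {x} → U x → TwoNeighbours E x)
  (a : Fin n) (Ua : U a)
  (connected : ∀ (κ : Fin n → Bool) → (∀ {x y} → E x y → κ x ≡ true → κ y ≡ true) →
               κ a ≡ false → ∀ {x} → U x → κ x ≡ false)
  where

  two-neighbours : ∀ {x y z v} → y ≢ z → E x y → E x z → E x v → v ≡ y ⊎ v ≡ z
  two-neighbours {x} y≢z xy xz xv with degree-two (E⇒U xy)
  ... | _ , _ , _ , _ , only with only xy | only xz | only xv
  ... | inj₁ p | inj₁ q | _      = ⊥-elim (y≢z (trans p (sym q)))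
  ... | inj₂ p | inj₂ q | _      = ⊥-elim (y≢z (trans p (sym q)))
  ... | inj₁ p | inj₂ q | inj₁ r = inj₁ (trans r (sym p))
  ... | inj₁ p | inj₂ q | inj₂ r = inj₂ (trans r (sym q))
  ... | inj₂ p | inj₁ q | inj₁ r = inj₂ (trans r (sym q))
  ... | inj₂ p | inj₁ q | inj₂ r = inj₁ (trans r (sym p))

  continue : ∀ {x y} → E x y → Σ[ z ∈ Fin n ] (E y z × z ≢ x)
  continue {x} xy with degree-two (E⇒U (E-sym xy))
  ... | (p , q) , p≢q , yp , yq , _ with p ≟ᶠ x
  ... | yes p≡x = q , yq , λ q≡x → p≢q (trans p≡x (sym q≡x))
  ... | no p≢x  = p , yp , p≢x

  Step : Set
  Step = Σ (Fin n × Fin n) λ (x , y) → E x y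

  extend : Step → Step
  extend ((_ , y) , xy) = (y , proj₁ (continue xy)) , proj₁ (proj₂ (continue xy))

  walk : ℕ → Step
  walk zero    = (a , proj₁ (proj₁ (degree-two Ua))) , proj₁ (proj₂ (proj₂ (degree-two Ua)))
  walk (suc t) = extend (walk t)

  w : ℕ → Fin n
  w t = proj₁ (proj₁ (walk t))

  w-edge : ∀ t → E (w t) (w (suc t))
  w-edge t = proj₂ (walk t)

  w-no-backtrack : ∀ t → w (suc (suc t)) ≢ w t
  w-no-backtrack t = proj₂ (proj₂ (continue (w-edge t)))

  w-U : ∀ t → U (w t)
  w-U t = E⇒U (w-edge t)

  Repeats : ℕ → Set
  Repeats t = ∃[ s ] (s < t × w s ≡ w t)

  some-repeat : ∃ Repeats
  some-repeat with pigeonhole (n<1+n n) (λ (i : Fin (suc n)) → w (toℕ i))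
  ... | i , j , i<j , wi≡wj = toℕ j , toℕ i , i<j , wi≡wj

  first-repeat : ∃[ T ] Least Repeats T
  first-repeat = minimal-witness (λ t → anyUpTo? (λ s → w s ≟ᶠ w t) t) _ (proj₂ some-repeat)

  T : ℕ
  T = proj₁ first-repeat

  w-injective-below-T : ∀ {s t} → s < T → t < T → w s ≡ w t → s ≡ t
  w-injective-below-T {s} {t} s<T t<T ws≡wt with <-cmp s t
  ... | tri< s<t _ _ = ⊥-elim (proj₂ (proj₂ first-repeat) t t<T (s , s<t , ws≡wt))
  ... | tri≈ _ s≡t _ = s≡t
  ... | tri> _ _ t<s = ⊥-elim (proj₂ (proj₂ first-repeat) s s<T (t , t<s , sym ws≡wt))

  -- A first return to w (suc s) would give that vertex a third neighbour w t.
  no-later-return : ∀ {s t} → s < t → suc t ≡ T → w (suc s) ≢ w (suc t)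
  no-later-return {s} {t} s<t 1+t≡T ws≡wt
    with two-neighbours (λ e → w-no-backtrack s (sym e)) (E-sym (w-edge s)) (w-edge (suc s))
                        (subst (λ x → E x (w t)) (sym ws≡wt) (E-sym (w-edge t)))
  ... | inj₁ wt≡ws = <-irrefl (w-injective-below-T (<-trans s<t t<T) t<T (sym wt≡ws)) s<t
    where t<T = subst (t <_) 1+t≡T ≤-refl
  ... | inj₂ wt≡w2+s with <-cmp (suc (suc s)) (suc t)
  ...   | tri< 2+s<1+t _ _ = w-no-backtrack (suc s) (trans (cong (w ∘ suc) (sym t≡2+s)) (sym ws≡wt))
    where
    t≡2+s : t ≡ suc (suc s)
    t≡2+s = w-injective-below-T (subst (t <_) 1+t≡T ≤-refl) (subst (suc (suc s) <_) 1+t≡T 2+s<1+t) wt≡w2+s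
  ...   | tri≈ _ 2+s≡1+t _ =
          E-irrefl (subst (E (w t)) (trans (sym ws≡wt) (cong w (suc-injective 2+s≡1+t))) (w-edge t))
  ...   | tri> _ _ (s≤s t<1+s) = <-irrefl refl (≤-trans t<1+s s<t)

  returns-to-start : w T ≡ a
  returns-to-start = from-repeat T refl (proj₁ (proj₂ first-repeat))
    where
    from-repeat : ∀ t → t ≡ T → Repeats t → w t ≡ a
    from-repeat t       _     (zero , _ , w0≡wt)            = sym w0≡wt
    from-repeat zero    _     (suc s , () , _)
    from-repeat (suc t) 1+t≡T (suc s , s≤s s<t , ws≡wt) = ⊥-elim (no-later-return s<t 1+t≡T ws≡wt)

  T-large : ∃[ k ] T ≡ suc (suc (suc k))
  T-large = three-or-more T refl (proj₁ (proj₂ first-repeat))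
    where
    three-or-more : ∀ t → t ≡ T → Repeats t → ∃[ k ] t ≡ suc (suc (suc k))
    three-or-more zero                _   (_ , () , _)
    three-or-more (suc zero)          1≡T _ =
      ⊥-elim (E-irrefl (subst (E a) (trans (cong w 1≡T) returns-to-start) (w-edge 0)))
    three-or-more (suc (suc zero))    2≡T _ = ⊥-elim (w-no-backtrack 0 (trans (cong w 2≡T) returns-to-start))
    three-or-more (suc (suc (suc k))) _   _ = k , refl

  module Cycle (k : ℕ) (T≡3+k : T ≡ suc (suc (suc k))) where

    c : Fin (suc (suc (suc k))) → Fin n
    c i = w (toℕ i)

    c-edge : ∀ i → E (c i) (c (next i))
    c-edge i with lastOrInject₁ i
    ... | last rewrite next-fromℕ (suc (suc k)) | toℕ-fromℕ k =
          subst (E (w (suc (suc k)))) (trans (cong w (sym T≡3+k)) returns-to-start) (w-edge (suc (suc k)))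
    ... | inject j rewrite next-inject₁ j | toℕ-inject₁ j = w-edge (toℕ j)

    c-injective : Injective _≡_ _≡_ c
    c-injective {i} {j} ci≡cj = toℕ-injective (w-injective-below-T (below-T i) (below-T j) ci≡cj)
      where
      below-T : ∀ i → toℕ i < T
      below-T i = subst (toℕ i <_) (sym T≡3+k) (toℕ<n i)

    c-neighbours : ∀ i {y} → E (c i) y → y ≡ c (next i) ⊎ y ≡ c (prev i)
    c-neighbours i = two-neighbours (λ e → prev≢next i (c-injective (sym e))) (c-edge i)
                       (E-sym (subst (E (c (prev i))) (cong c (next-prev i)) (c-edge (prev i))))

    visited? : ∀ x → Dec (∃[ i ] c i ≡ x)
    visited? x = any? (λ i → c i ≟ᶠ x)

    unvisited : Fin n → Bool
    unvisited x = not (does (visited? x))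

    unvisited-c : ∀ i → unvisited (c i) ≡ false
    unvisited-c i = cong not (dec-true (visited? (c i)) (i , refl))

    unvisited-closed : ∀ {x y} → E x y → unvisited x ≡ true → unvisited y ≡ true
    unvisited-closed {x} {y} xy ux = cong not (dec-false (visited? y) y-unvisited)
      where
      y-unvisited : ¬ (∃[ i ] c i ≡ y)
      y-unvisited (i , refl) with c-neighbours i (E-sym xy)
      ... | inj₁ refl = contradiction (trans (sym ux) (unvisited-c (next i))) λ ()
      ... | inj₂ refl = contradiction (trans (sym ux) (unvisited-c (prev i))) λ ()

    covers : ∀ {v} → U v → ∃[ i ] c i ≡ v
    covers {v} Uv = decidable-stable (visited? v) λ v-unvisited →
      contradiction (trans (sym (cong not (dec-false (visited? v) v-unvisited)))
                           (connected unvisited unvisited-closed (unvisited-c zero) Uv)) λ ()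

    hamiltonian : HamCycleOn E U
    hamiltonian = k , c , c-injective , (λ v → mk⇔ covers λ { (i , refl) → w-U (toℕ i) })
                , λ u v → mk⇔ cycle-edge edge-on-cycle
      where
      cycle-edge : ∀ {u v} → E u v → ∃[ i ] Joins (c i , c (next i)) u v
      cycle-edge uv with covers (E⇒U uv)
      ... | i , refl with c-neighbours i uv
      ...   | inj₁ refl = i , inj₁ (refl , refl)
      ...   | inj₂ refl = prev i , inj₂ (refl , cong c (next-prev i))
      edge-on-cycle : ∀ {u v} → ∃[ i ] Joins (c i , c (next i)) u v → E u v
      edge-on-cycle (i , inj₁ (refl , refl)) = c-edge i
      edge-on-cycle (i , inj₂ (refl , refl)) = E-sym (c-edge i)

  twoRegular-connected⇒hamiltonian : HamCycleOn E U
  twoRegular-connected⇒hamiltonian = Cycle.hamiltonian (proj₁ T-large) (proj₂ T-large)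

module _ {n} {X : Subset n} (γ : Conf X) where

  partner : Fin n → Fin n
  partner x with x ∈? V₁ γ
  ... | yes x∈V₁ = proj₁ (M-perf γ x x∈V₁)
  ... | no _     = x

  partner-M : ∀ {x} → x ∈ V₁ γ → M γ x (partner x)
  partner-M {x} x∈V₁ with x ∈? V₁ γ
  ... | yes x∈V₁′ = proj₁ (proj₂ (M-perf γ x x∈V₁′))
  ... | no x∉V₁   = ⊥-elim (x∉V₁ x∈V₁)

  partner-unique : ∀ {x y} → M γ x y → y ≡ partner x
  partner-unique {x} {y} xy with x ∈? V₁ γ
  ... | yes x∈V₁ = proj₂ (proj₂ (M-perf γ x x∈V₁)) y xy
  ... | no x∉V₁  = ⊥-elim (x∉V₁ (M-dom γ x y xy))

module _ {n m} (G : Graph n m) {S : EdgeSet m} where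

  SEdge-sym : ∀ {x y} → SEdge G S x y → SEdge G S y x
  SEdge-sym (e , e∈S , inj₁ ends≡) = e , e∈S , inj₂ ends≡
  SEdge-sym (e , e∈S , inj₂ ends≡) = e , e∈S , inj₁ ends≡

  SEdge-irrefl : ∀ {x} → ¬ SEdge G S x x
  SEdge-irrefl (e , _ , inj₁ (refl , b≡x)) = loopless G e (sym b≡x)
  SEdge-irrefl (e , _ , inj₂ (refl , b≡x)) = loopless G e (sym b≡x)

  SEdge-disjoint : ∀ {X} (γ : Conf X) → (∀ e → e ∈ S → ¬ M γ (proj₁ (ends G e)) (proj₂ (ends G e))) →
                   ∀ {x y} → SEdge G S x y → ¬ M γ x y
  SEdge-disjoint γ S∩M≡∅ (e , e∈S , inj₁ (refl , refl)) xy = S∩M≡∅ e e∈S xy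
  SEdge-disjoint γ S∩M≡∅ (e , e∈S , inj₂ (refl , refl)) xy = S∩M≡∅ e e∈S (M-sym γ _ _ xy)

module Compliance {n m} (G : Graph n m) {X : Subset n} (γ : Conf X) {S : EdgeSet m}
                  (compliant : Compliant G γ S) where

  E : Fin n → Fin n → Set
  E x y = SEdge G S x y ⊎ M γ x y

  S∩M≡∅ : ∀ {x y} → SEdge G S x y → ¬ M γ x y
  S∩M≡∅ = SEdge-disjoint G γ (proj₁ compliant)

  k : ℕ
  k = proj₁ (proj₂ compliant)

  c : Fin (suc (suc (suc k))) → Fin n
  c = proj₁ (proj₂ (proj₂ compliant))

  c-injective : ∀ {p q} → c p ≡ c q → p ≡ q
  c-injective = proj₁ (proj₂ (proj₂ (proj₂ compliant)))

  position : ∀ {x} → x ∉ V₂ γ → ∃[ p ] c p ≡ x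
  position {x} = Equivalence.to (proj₁ (proj₂ (proj₂ (proj₂ (proj₂ compliant)))) x)

  c-∉V₂ : ∀ p → c p ∉ V₂ γ
  c-∉V₂ p = Equivalence.from (proj₁ (proj₂ (proj₂ (proj₂ (proj₂ compliant)))) (c p)) (p , refl)

  private
    E⇒consecutive : ∀ u v → E u v → ∃[ i ] Joins (c i , c (next i)) u v
    E⇒consecutive u v = Equivalence.to (proj₂ (proj₂ (proj₂ (proj₂ (proj₂ compliant)))) u v)

    consecutive⇒E : ∀ u v → ∃[ i ] Joins (c i , c (next i)) u v → E u v
    consecutive⇒E u v = Equivalence.from (proj₂ (proj₂ (proj₂ (proj₂ (proj₂ compliant)))) u v)

  E-position : ∀ {x y} → E x y → ∃[ p ] c p ≡ x
  E-position {x} {y} xy with E⇒consecutive x y xy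
  ... | i , inj₁ (ci≡x , _) = i , ci≡x
  ... | i , inj₂ (_ , ci+1≡x) = next i , ci+1≡x

  edge-next : ∀ p → E (c p) (c (next p))
  edge-next p = consecutive⇒E _ _ (p , inj₁ (refl , refl))

  edge-prev : ∀ p → E (c p) (c (prev p))
  edge-prev p = consecutive⇒E _ _ (prev p , inj₂ (refl , cong c (next-prev p)))

  cycle-neighbours : ∀ p {y} → E (c p) y → y ≡ c (next p) ⊎ y ≡ c (prev p)
  cycle-neighbours p {y} py with E⇒consecutive _ _ py
  ... | i , inj₁ (ci≡cp , ci+1≡y) rewrite c-injective ci≡cp = inj₁ (sym ci+1≡y)
  ... | i , inj₂ (ci≡y , ci+1≡cp) =
        inj₂ (trans (sym ci≡y) (cong c (trans (sym (prev-next i)) (cong prev (c-injective ci+1≡cp)))))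

  next≢prev : ∀ p → c (next p) ≢ c (prev p)
  next≢prev p cn≡cp = prev≢next p (sym (c-injective cn≡cp))

  S-edge-outside-V₁ : ∀ {x y} → x ∉ V₁ γ → E x y → SEdge G S x y
  S-edge-outside-V₁ x∉V₁ (inj₁ xy) = xy
  S-edge-outside-V₁ x∉V₁ (inj₂ xy) = ⊥-elim (x∉V₁ (M-dom γ _ _ xy))

  S-neighbour-opposite-partner : ∀ {p} → c p ∈ V₁ γ → ∀ {y z} → E (c p) z → y ≢ z →
                                 (∀ {v} → E (c p) v → v ≡ y ⊎ v ≡ z) → partner γ (c p) ≡ y →
                                 ∃[ y ] (SEdge G S (c p) y × (∀ {v} → SEdge G S (c p) v → v ≡ y))
  S-neighbour-opposite-partner {p} cp∈V₁ {y} {z} pz y≢z only partner≡y = z , S-edge pz , unique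
    where
    partner-is-y : ∀ {v} → M γ (c p) v → v ≡ y
    partner-is-y pv = trans (partner-unique γ pv) partner≡y
    S-edge : E (c p) z → SEdge G S (c p) z
    S-edge (inj₁ pz) = pz
    S-edge (inj₂ pz) = ⊥-elim (y≢z (sym (partner-is-y pz)))
    unique : ∀ {v} → SEdge G S (c p) v → v ≡ z
    unique pv with only (inj₁ pv)
    ... | inj₁ refl = ⊥-elim (S∩M≡∅ pv (subst (M γ (c p)) partner≡y (partner-M γ cp∈V₁)))
    ... | inj₂ v≡z  = v≡z

  unique-S-neighbour : ∀ p → c p ∈ V₁ γ →
                       ∃[ y ] (SEdge G S (c p) y × (∀ {v} → SEdge G S (c p) v → v ≡ y))
  unique-S-neighbour p cp∈V₁ with cycle-neighbours p (inj₂ (partner-M γ cp∈V₁))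
  ... | inj₁ partner≡next = S-neighbour-opposite-partner cp∈V₁ (edge-prev p) (next≢prev p)
                              (λ pv → cycle-neighbours p pv) partner≡next
  ... | inj₂ partner≡prev = S-neighbour-opposite-partner cp∈V₁ (edge-next p) (λ e → next≢prev p (sym e))
                              (λ pv → Sum.swap (cycle-neighbours p pv)) partner≡prev

  cycle-meets-V₁ : ¬ CycleIn G S → ∃[ p ] c p ∈ V₁ γ
  cycle-meets-V₁ acyclic with any? (λ p → c p ∈? V₁ γ)
  ... | yes meets = meets
  ... | no ¬meets = ⊥-elim (acyclic (k , c , c-injective ,
                      λ p → S-edge-outside-V₁ (λ cp∈V₁ → ¬meets (p , cp∈V₁)) (edge-next p)))

  S-neighbour-unique : ∀ {x} → x ∈ V₁ γ → ∀ {y v} → SEdge G S x y → SEdge G S x v → v ≡ y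
  S-neighbour-unique x∈V₁ xy xv with position (disj₁₂ γ _ x∈V₁)
  ... | p , refl with unique-S-neighbour p x∈V₁
  ...   | _ , _ , only = trans (only xv) (sym (only xy))

  cycle-not-in-pair : ∀ x y → ¬ (∀ q → c q ≡ x ⊎ c q ≡ y)
  cycle-not-in-pair x y in-pair =
    let i , j , i<j , same-side = pigeonhole (s≤s (s≤s (s≤s z≤n))) (λ q → side (in-pair q))
    in <-irrefl (cong toℕ (c-injective (same-vertex (in-pair i) (in-pair j) same-side))) i<j
    where
    side : ∀ {A B : Set} → A ⊎ B → Fin 2
    side = Sum.[ (λ _ → zero) , (λ _ → suc zero) ]
    same-vertex : ∀ {i j} (pi : c i ≡ x ⊎ c i ≡ y) (pj : c j ≡ x ⊎ c j ≡ y) → side pi ≡ side pj → c i ≡ c j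
    same-vertex (inj₁ ci≡x) (inj₁ cj≡x) _  = trans ci≡x (sym cj≡x)
    same-vertex (inj₂ ci≡y) (inj₂ cj≡y) _  = trans ci≡y (sym cj≡y)
    same-vertex (inj₁ _)    (inj₂ _)    ()
    same-vertex (inj₂ _)    (inj₁ _)    ()

-- Cuts and their parities

module Cuts {n m} (G : Graph n m) where

  Consistent : EdgeSet m → Subset n → Set
  Consistent S κ = ∀ e → e ∈ S → lookup κ (proj₁ (ends G e)) ≡ lookup κ (proj₂ (ends G e))

  consistent? : ∀ S κ → Dec (Consistent S κ)
  consistent? S κ =
    all? (λ e → (e ∈? S) →-dec (lookup κ (proj₁ (ends G e)) ≟ᵇ lookup κ (proj₂ (ends G e))))

  consistent-SEdge : ∀ {S κ x y} → Consistent S κ → SEdge G S x y → lookup κ x ≡ lookup κ y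
  consistent-SEdge κ-cons (e , e∈S , inj₁ (refl , refl)) = κ-cons e e∈S
  consistent-SEdge κ-cons (e , e∈S , inj₂ (refl , refl)) = sym (κ-cons e e∈S)

  Trace : EdgeSet m → Subset n → Subset n → Set
  Trace S V l = ∃[ κ ] (Consistent S κ × (∀ x → lookup l x ≡ lookup κ x ∧ lookup V x))

  trace? : ∀ S V l → Dec (Trace S V l)
  trace? S V l =
    anySubset? (λ κ → consistent? S κ ×-dec all? (λ x → lookup l x ≟ᵇ (lookup κ x ∧ lookup V x)))

  MConsistent : ∀ {X : Subset n} → Conf X → Subset n → Set
  MConsistent γ l = ∀ x → x ∈ V₁ γ → lookup l x ≡ lookup l (partner γ x)

  mConsistent? : ∀ {X : Subset n} (γ : Conf X) l → Dec (MConsistent γ l)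
  mConsistent? γ l = all? (λ x → (x ∈? V₁ γ) →-dec (lookup l x ≟ᵇ lookup l (partner γ x)))

  mConsistent-M : ∀ {X} {γ : Conf X} {l x y} → MConsistent γ l → M γ x y → lookup l x ≡ lookup l y
  mConsistent-M {γ = γ} {l} l-cons xy =
    trans (l-cons _ (M-dom γ _ _ xy)) (cong (lookup l) (sym (partner-unique γ xy)))

  trace-⊕ : ∀ {S V} l l′ → Trace S V l → Trace S V l′ → Trace S V (l ⊕ l′)
  trace-⊕ {S} {V} l l′ (κ , κ-cons , l≡κ∩V) (κ′ , κ′-cons , l′≡κ′∩V) = κ ⊕ κ′ , cons , pointwise
    where
    cons : Consistent S (κ ⊕ κ′)
    cons e e∈S = trans (lookup-⊕ κ κ′ _)
                       (trans (cong₂ _xor_ (κ-cons e e∈S) (κ′-cons e e∈S)) (sym (lookup-⊕ κ κ′ _)))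
    pointwise : ∀ x → lookup (l ⊕ l′) x ≡ lookup (κ ⊕ κ′) x ∧ lookup V x
    pointwise x = begin
      lookup (l ⊕ l′) x
        ≡⟨ lookup-⊕ l l′ x ⟩
      lookup l x xor lookup l′ x
        ≡⟨ cong₂ _xor_ (l≡κ∩V x) (l′≡κ′∩V x) ⟩
      (lookup κ x ∧ lookup V x) xor (lookup κ′ x ∧ lookup V x)
        ≡⟨ ∧-distribʳ-xor (lookup V x) (lookup κ x) (lookup κ′ x) ⟨
      (lookup κ x xor lookup κ′ x) ∧ lookup V x
        ≡⟨ cong (_∧ lookup V x) (lookup-⊕ κ κ′ x) ⟨
      lookup (κ ⊕ κ′) x ∧ lookup V x ∎
      where open ≡-Reasoning

  mConsistent-⊕ : ∀ {X} {γ : Conf X} l l′ → MConsistent γ l → MConsistent γ l′ → MConsistent γ (l ⊕ l′)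
  mConsistent-⊕ {γ = γ} l l′ l-cons l′-cons x x∈V₁ =
    trans (lookup-⊕ l l′ x) (trans (cong₂ _xor_ (l-cons x x∈V₁) (l′-cons x x∈V₁)) (sym (lookup-⊕ l l′ _)))

  matchingVector : ∀ {X : Subset n} → Conf X → Subset n → Bool
  matchingVector γ l = does (mConsistent? γ l)

lookup-∅ : ∀ {n} (x : Fin n) → lookup ∅ x ≡ false
lookup-∅ x = lookup-replicate x false

module Anchored {n m} (G : Graph n m) {X : Subset n} (γ : Conf X) {S : EdgeSet m}
                (compliant : Compliant G γ S) (acyclic : ¬ CycleIn G S) where

  open Cuts G
  open Compliance G γ compliant

  a : Fin n
  a = c (proj₁ (cycle-meets-V₁ acyclic))

  -- Keeping a outside counts each cut once rather than together with its complement.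
  cutVector : Subset n → Bool
  cutVector l = not (lookup l a) ∧ does (trace? S (V₁ γ) l)

  anchored-trace-empty : ∀ {l} → lookup l a ≡ false → Trace S (V₁ γ) l → MConsistent γ l →
                         ∀ x → lookup l x ≡ false
  anchored-trace-empty {l} la≡0 (κ , κ-cons , l≡κ∩V₁) l-cons x = l-vanishes (lookup (V₁ γ) x) refl
    where
    κ≡l-on-V₁ : ∀ {y} → y ∈ V₁ γ → lookup κ y ≡ lookup l y
    κ≡l-on-V₁ {y} y∈V₁ =
      sym (trans (l≡κ∩V₁ y) (trans (cong (lookup κ y ∧_) ([]=⇒lookup y∈V₁)) (∧-identityʳ _)))
    κ-propagates : ∀ p → lookup κ (c p) ≡ false → lookup κ (c (next p)) ≡ false
    κ-propagates p κp≡0 with edge-next p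
    ... | inj₁ S-edge = trans (sym (consistent-SEdge {S} {κ} κ-cons S-edge)) κp≡0
    ... | inj₂ M-edge = begin
      lookup κ (c (next p)) ≡⟨ κ≡l-on-V₁ (M-dom γ _ _ (M-sym γ _ _ M-edge)) ⟩
      lookup l (c (next p)) ≡⟨ mConsistent-M {γ = γ} {l} l-cons M-edge ⟨
      lookup l (c p)        ≡⟨ κ≡l-on-V₁ (M-dom γ _ _ M-edge) ⟨
      lookup κ (c p)        ≡⟨ κp≡0 ⟩
      false                 ∎
      where open ≡-Reasoning
    κ-vanishes-on-cycle : ∀ p → lookup κ (c p) ≡ false
    κ-vanishes-on-cycle = next-closed⇒universal _ κ-propagates
                            (trans (κ≡l-on-V₁ (proj₂ (cycle-meets-V₁ acyclic))) la≡0)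
    l-vanishes : ∀ b → lookup (V₁ γ) x ≡ b → lookup l x ≡ false
    l-vanishes false x∉V₁ = trans (l≡κ∩V₁ x) (trans (cong (lookup κ x ∧_) x∉V₁) (∧-zeroʳ _))
    l-vanishes true  x∈V₁ with position (disj₁₂ γ x (lookup⇒[]= x (V₁ γ) x∈V₁))
    ... | p , refl = trans (sym (κ≡l-on-V₁ (lookup⇒[]= x (V₁ γ) x∈V₁))) (κ-vanishes-on-cycle p)

  cutParity : Conf X → Bool
  cutParity γ′ = parity (subsets X) (λ l → cutVector l ∧ matchingVector γ′ l)

  diagonal-odd : cutParity γ ≡ true
  diagonal-odd = trans (parity-point {X = X} _ ⊥⊆ only-empty) at-empty
    where
    empty-trace : Trace S (V₁ γ) ∅
    empty-trace = ∅ , (λ e _ → trans (lookup-∅ (proj₁ (ends G e))) (sym (lookup-∅ (proj₂ (ends G e))))) ,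
                  λ x → trans (lookup-∅ x) (sym (cong (_∧ lookup (V₁ γ) x) (lookup-∅ x)))
    at-empty : cutVector ∅ ∧ matchingVector γ ∅ ≡ true
    at-empty rewrite lookup-∅ a | dec-true (trace? S (V₁ γ) ∅) empty-trace
                   | dec-true (mConsistent? γ ∅) (λ x _ → trans (lookup-∅ x) (sym (lookup-∅ (partner γ x)))) = refl
    only-empty : ∀ l → l ≢ ∅ → cutVector l ∧ matchingVector γ l ≡ false
    only-empty l l≢∅ with lookup l a in la
    ... | true  = refl
    ... | false = ∧-false (λ tr mc → l≢∅ (trans (sym (tabulate∘lookup l))
                    (trans (tabulate-cong (λ x → trans (anchored-trace-empty {l} la (witness (trace? S (V₁ γ) l) tr)
                                                                               (witness (mConsistent? γ l) mc) x)
                                                       (sym (lookup-∅ x))))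
                           (tabulate∘lookup ∅))))

module OffDiagonal {n m} (G : Graph n m) {X : Subset n} (γ : Conf X) {S : EdgeSet m}
                   (compliant : Compliant G γ S) (acyclic : ¬ CycleIn G S)
                   (γ′ : Conf X) (V₁≡ : V₁ γ′ ≡ V₁ γ) (V₂≡ : V₂ γ′ ≡ V₂ γ)
                   (odd : Anchored.cutParity G γ compliant acyclic γ′ ≡ true)
                   where

  open Cuts G
  open Compliance G γ compliant
  open Anchored G γ compliant acyclic

  E′ : Fin n → Fin n → Set
  E′ x y = SEdge G S x y ⊎ M γ′ x y

  U′ : Fin n → Set
  U′ x = x ∉ V₂ γ′

  E′-sym : ∀ {x y} → E′ x y → E′ y x
  E′-sym (inj₁ xy) = inj₁ (SEdge-sym G xy)
  E′-sym (inj₂ xy) = inj₂ (M-sym γ′ _ _ xy)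

  V₁′⇒V₁ : ∀ {x} → x ∈ V₁ γ′ → x ∈ V₁ γ
  V₁′⇒V₁ {x} = subst (x ∈_) V₁≡

  V₁⇒V₁′ : ∀ {x} → x ∈ V₁ γ → x ∈ V₁ γ′
  V₁⇒V₁′ {x} = subst (x ∈_) (sym V₁≡)

  U′⇒U : ∀ {x} → U′ x → x ∉ V₂ γ
  U′⇒U {x} x∉V₂′ x∈V₂ = x∉V₂′ (subst (x ∈_) (sym V₂≡) x∈V₂)

  U⇒U′ : ∀ {x} → x ∉ V₂ γ → U′ x
  U⇒U′ {x} x∉V₂ x∈V₂′ = x∉V₂ (subst (x ∈_) V₂≡ x∈V₂′)

  Closed : (Fin n → Bool) → Set
  Closed κ = ∀ {x y} → E′ x y → κ x ≡ true → κ y ≡ true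

  closed-constant-on-edges : ∀ {κ} → Closed κ → ∀ {x y} → E′ x y → κ x ≡ κ y
  closed-constant-on-edges {κ} κ-closed {x} {y} xy with κ x in κx | κ y in κy
  ... | true  | true  = refl
  ... | false | false = refl
  ... | true  | false = trans (sym (κ-closed xy κx)) κy
  ... | false | true  = trans (sym κx) (κ-closed (E′-sym xy) κy)

  module Flip {κ : Fin n → Bool} (κ-closed : Closed κ) (κa≡0 : κ a ≡ false) where

    C : Subset n
    C = tabulate (λ x → κ x ∧ lookup (V₁ γ) x)

    lookup-C : ∀ x → lookup C x ≡ κ x ∧ lookup (V₁ γ) x
    lookup-C = lookup∘tabulate _

    C⊆X : C ⊆ X
    C⊆X {x} x∈C with lookup (V₁ γ) x in x∈V₁
    ... | true  = V₁⊆X γ x (lookup⇒[]= x (V₁ γ) x∈V₁)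
    ... | false = contradiction (trans (sym ([]=⇒lookup x∈C))
                                       (trans (lookup-C x) (trans (cong (κ x ∧_) x∈V₁) (∧-zeroʳ _)))) λ ()

    C-trace : Trace S (V₁ γ) C
    C-trace = tabulate κ , consistent ,
              λ x → trans (lookup-C x) (cong (_∧ lookup (V₁ γ) x) (sym (lookup∘tabulate κ x)))
      where
      consistent : Consistent S (tabulate κ)
      consistent e e∈S = trans (lookup∘tabulate κ _)
                               (trans (closed-constant-on-edges κ-closed (inj₁ (e , e∈S , inj₁ (refl , refl))))
                                      (sym (lookup∘tabulate κ _)))

    C-mConsistent : MConsistent γ′ C
    C-mConsistent x x∈V₁′ =
      trans (lookup-C x)
            (trans (cong₂ _∧_ (closed-constant-on-edges κ-closed (inj₂ x~partner))
                              (trans ([]=⇒lookup (V₁′⇒V₁ x∈V₁′)) (sym ([]=⇒lookup partner∈V₁))))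
                   (sym (lookup-C _)))
      where
      x~partner = partner-M γ′ x∈V₁′
      partner∈V₁ = V₁′⇒V₁ (M-dom γ′ _ _ (M-sym γ′ _ _ x~partner))

    flip-invariant : ∀ l → cutVector (l ⊕ C) ∧ matchingVector γ′ (l ⊕ C) ≡ cutVector l ∧ matchingVector γ′ l
    flip-invariant l =
      cong₂ _∧_ (cong₂ _∧_ (cong not a-unchanged)
                           (does-invariant-⊕ (trace? S (V₁ γ)) C (λ {l} tr → trace-⊕ {S} {V₁ γ} l C tr C-trace) l))
                (does-invariant-⊕ (mConsistent? γ′) C (λ {l} mc → mConsistent-⊕ {γ = γ′} l C mc C-mConsistent) l)
      where
      a-unchanged : lookup (l ⊕ C) a ≡ lookup l a
      a-unchanged = trans (lookup-⊕ l C a) (trans (cong (lookup l a xor_) (trans (lookup-C a) (cong (_∧ _) κa≡0)))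
                                                  (xor-identityʳ _))

  -- Flipping l by C is a fixed-point-free involution preserving the summands, so a nonempty C would
  -- make the count even.
  closed-avoids-V₁ : ∀ {κ} → Closed κ → κ a ≡ false → ∀ {v} → v ∈ V₁ γ → κ v ≡ false
  closed-avoids-V₁ {κ} κ-closed κa≡0 {v} v∈V₁ with κ v in κv
  ... | false = refl
  ... | true  = contradiction (trans (sym odd) (parity-involution _ C⊆X v∈C flip-invariant)) λ ()
    where
    open Flip κ-closed κa≡0
    v∈C : v ∈ C
    v∈C = lookup⇒[]= v C (trans (lookup-C v) (cong₂ _∧_ κv ([]=⇒lookup v∈V₁)))

  -- A κ-side avoiding V₁ is closed along the cycle c, whose M γ-edges start in V₁.
  connected : ∀ (κ : Fin n → Bool) → Closed κ → κ a ≡ false → ∀ {x} → U′ x → κ x ≡ false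
  connected κ κ-closed κa≡0 {x} x∈U′ with κ x in κx | position (U′⇒U x∈U′)
  ... | false | _        = refl
  ... | true  | p , refl =
        contradiction (trans (sym κa≡0) (next-closed⇒universal (λ q → κ (c q) ≡ true) step κx _)) λ ()
    where
    step : ∀ q → κ (c q) ≡ true → κ (c (next q)) ≡ true
    step q κq with edge-next q
    ... | inj₁ S-edge = κ-closed (inj₁ S-edge) κq
    ... | inj₂ M-edge = contradiction (trans (sym κq) (closed-avoids-V₁ κ-closed κa≡0 (M-dom γ _ _ M-edge))) λ ()

  closed-constant : ∀ {κ} → Closed κ → ∀ {x y} → U′ x → U′ y → κ x ≡ κ y
  closed-constant {κ} κ-closed {x} {y} x∈U′ y∈U′ with κ a in κa
  ... | false = trans (connected κ κ-closed κa x∈U′) (sym (connected κ κ-closed κa y∈U′))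
  ... | true  = not-injective (trans (connected (not ∘ κ) ¬κ-closed (cong not κa) x∈U′)
                                   (sym (connected (not ∘ κ) ¬κ-closed (cong not κa) y∈U′)))
    where
    ¬κ-closed : Closed (not ∘ κ)
    ¬κ-closed xy = trans (cong not (sym (closed-constant-on-edges κ-closed xy)))

  -- Such an edge would make {x, y} a union of components of S ∪ M′, but c has a third vertex.
  S∩M′≡∅ : ∀ {x y} → SEdge G S x y → ¬ M γ′ x y
  S∩M′≡∅ {x} {y} xy x~y = cycle-not-in-pair x y λ q →
    from-pair (trans (closed-constant pair-closed (U⇒U′ (c-∉V₂ q)) (disj₁₂ γ′ x (M-dom γ′ x y x~y)))
                     (to-pair (inj₁ refl)))
    where
    pair : Fin n → Bool
    pair z = does (z ≟ᶠ x) ∨ does (z ≟ᶠ y)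
    from-pair : ∀ {z} → pair z ≡ true → z ≡ x ⊎ z ≡ y
    from-pair {z} z∈pair with z ≟ᶠ x | z ≟ᶠ y
    ... | yes z≡x | _       = inj₁ z≡x
    ... | no _    | yes z≡y = inj₂ z≡y
    to-pair : ∀ {z} → z ≡ x ⊎ z ≡ y → pair z ≡ true
    to-pair {z} z∈pair with z ≟ᶠ x | z ≟ᶠ y
    ... | yes _   | _       = refl
    ... | no _    | yes _   = refl
    ... | no z≢x  | no z≢y  = ⊥-elim (Sum.[ z≢x , z≢y ] z∈pair)
    other-end : ∀ {u v w} → u ∈ V₁ γ′ → SEdge G S u w → M γ′ u w → E′ u v → v ≡ w
    other-end u∈V₁′ uw _   (inj₁ uv) = S-neighbour-unique (V₁′⇒V₁ u∈V₁′) uw uv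
    other-end _     _  u~w (inj₂ u~v) = trans (partner-unique γ′ u~v) (sym (partner-unique γ′ u~w))
    pair-closed : Closed pair
    pair-closed {u} uv u∈pair with from-pair {u} u∈pair
    ... | inj₁ refl = to-pair (inj₂ (other-end (M-dom γ′ _ _ x~y) xy x~y uv))
    ... | inj₂ refl =
          to-pair (inj₁ (other-end (M-dom γ′ _ _ (M-sym γ′ _ _ x~y)) (SEdge-sym G xy) (M-sym γ′ _ _ x~y) uv))

  E′-irrefl : ∀ {x} → ¬ E′ x x
  E′-irrefl (inj₁ xx) = SEdge-irrefl G xx
  E′-irrefl (inj₂ xx) = M-irrefl γ′ _ xx

  E′⇒U′ : ∀ {x y} → E′ x y → U′ x
  E′⇒U′ (inj₁ xy) with E-position (inj₁ xy)
  ... | p , refl = U⇒U′ (c-∉V₂ p)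
  E′⇒U′ (inj₂ x~y) = disj₁₂ γ′ _ (M-dom γ′ _ _ x~y)

  degree-two : ∀ {x} → U′ x → TwoNeighbours E′ x
  degree-two x∈U′ with position (U′⇒U x∈U′)
  ... | p , refl with c p ∈? V₁ γ
  ...   | no cp∉V₁ = (c (next p) , c (prev p)) , next≢prev p ,
                     inj₁ (S-edge-outside-V₁ cp∉V₁ (edge-next p)) ,
                     inj₁ (S-edge-outside-V₁ cp∉V₁ (edge-prev p)) , only
    where
    only : ∀ {v} → E′ (c p) v → v ≡ c (next p) ⊎ v ≡ c (prev p)
    only (inj₁ pv)  = cycle-neighbours p (inj₁ pv)
    only (inj₂ p~v) = ⊥-elim (cp∉V₁ (V₁′⇒V₁ (M-dom γ′ _ _ p~v)))
  ...   | yes cp∈V₁ with unique-S-neighbour p cp∈V₁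
  ...     | s , ps , s-only = (s , partner γ′ (c p)) , s≢partner , inj₁ ps , inj₂ p~partner , only
    where
    p~partner : M γ′ (c p) (partner γ′ (c p))
    p~partner = partner-M γ′ (V₁⇒V₁′ cp∈V₁)
    s≢partner : s ≢ partner γ′ (c p)
    s≢partner s≡partner = S∩M′≡∅ ps (subst (M γ′ (c p)) (sym s≡partner) p~partner)
    only : ∀ {v} → E′ (c p) v → v ≡ s ⊎ v ≡ partner γ′ (c p)
    only (inj₁ pv)  = inj₁ (s-only pv)
    only (inj₂ p~v) = inj₂ (partner-unique γ′ p~v)

  odd⇒compliant : Compliant G γ′ S
  odd⇒compliant =
    (λ e e∈S → S∩M′≡∅ (e , e∈S , inj₁ (refl , refl))) ,
    TwoRegular.twoRegular-connected⇒hamiltonian E′ U′ E′-sym E′-irrefl E′⇒U′ degree-two a (U⇒U′ (c-∉V₂ _)) connected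

-- The rank bound

map-proj₁-toList : ∀ {A : Set} {P : A → Set₁} {xs : List A} (pxs : All P xs) → map proj₁ (All.toList pxs) ≡ xs
map-proj₁-toList []         = refl
map-proj₁-toList (px ∷ pxs) = cong (_ ∷_) (map-proj₁-toList pxs)

module Bound {n m} (G : Graph n m) (X : Subset n) (ω : Fin m → ℕ)
             (unique-min : ∀ (γ : Conf X) S S′ → InMin ω G γ S → InMin ω G γ S′ → S ≡ S′) where

  Solution : Set₁
  Solution = Σ[ S ∈ EdgeSet m ] ∃[ γ ] InMin ω G {X} γ S

  weightOf : Solution → ℕ
  weightOf (S , _) = weight ω S

  row : Solution → Row
  row (S , γ , ((acyclic , _) , compliant) , _) =
    tagged (V₁ γ) (V₂ γ) (Anchored.cutVector G γ compliant acyclic) , tagged (V₁ γ) (V₂ γ) (Cuts.matchingVector G γ)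

  unit-diagonal : ∀ s → UnitDiagonal (coordinates X) (row s)
  unit-diagonal (S , γ , ((acyclic , _) , compliant) , _) =
    trans (inner-tagged (V₁ γ) (V₂ γ) _ _ (λ {v} → V₁⊆X γ v) (λ {v} → V₂⊆X γ v))
          (cong₂ _∧_ (dec-true ((V₁ γ ≟ˢ V₁ γ) ×-dec (V₂ γ ≟ˢ V₂ γ)) (refl , refl))
                     (Anchored.diagonal-odd G γ compliant acyclic))

  zero-above : ∀ s t → weightOf s ≤ weightOf t → proj₁ s ≢ proj₁ t → ZeroAbove (coordinates X) (row s) (row t)
  zero-above (S , γ , ((acyclic , deg≤2) , compliant) , _) (T , γ′ , T-min) wS≤wT S≢T =
    trans (inner-tagged (V₁ γ) (V₂ γ) _ _ (λ {v} → V₁⊆X γ′ v) (λ {v} → V₂⊆X γ′ v))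
          (∧-false λ same-tags odd → S≢T (unique-min γ′ S T (S-min same-tags odd) T-min))
    where
    S-min : does ((V₁ γ′ ≟ˢ V₁ γ) ×-dec (V₂ γ′ ≟ˢ V₂ γ)) ≡ true →
            Anchored.cutParity G γ compliant acyclic γ′ ≡ true →
            InMin ω G γ′ S
    S-min same-tags odd =
      ((acyclic , deg≤2) , OffDiagonal.odd⇒compliant G γ compliant acyclic γ′ (proj₁ V≡) (proj₂ V≡) odd) ,
      λ S′ partial compliant′ → ≤-trans wS≤wT (proj₂ T-min S′ partial compliant′)
      where V≡ = witness ((V₁ γ′ ≟ˢ V₁ γ) ×-dec (V₂ γ′ ≟ˢ V₂ γ)) same-tags

  byWeight : DecTotalOrder _ _ _
  byWeight = On.decTotalOrder ≤-decTotalOrder weightOf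

  open Sort byWeight using (sort; sort-↭; sort-↗)

  bound : ∀ L → Unique L → All (λ S → ∃[ γ ] InMin ω G {X} γ S) L → length L ≤ 2 ^ (3 * ∣ X ∣)
  bound L L-unique L-solutions = begin
    length L                      ≡⟨ cong length (map-proj₁-toList L-solutions) ⟨
    length (map proj₁ solutions)  ≡⟨ length-map proj₁ solutions ⟩
    length solutions              ≡⟨ ↭-length (sort-↭ solutions) ⟨
    length sorted                 ≡⟨ length-map row sorted ⟨
    length (map row sorted)       ≤⟨ unitLowerTriangular⇒length≤ (coordinates X) (map row sorted)
                                       (All.map⁺ (All.universal unit-diagonal sorted))
                                       (AllPairs.map⁺ (AllPairs.zipWith (λ {s} {t} (w≤ , S≢) → zero-above s t w≤ S≢)
                                                                         (increasing , distinct))) ⟩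
    length (coordinates X)        ≡⟨ length-coordinates X ⟩
    2 ^ (3 * ∣ X ∣)               ∎
    where
    open ≤-Reasoning
    solutions = All.toList L-solutions
    sorted = sort solutions
    increasing : AllPairs (λ s t → weightOf s ≤ weightOf t) sorted
    increasing = Sorted⇒AllPairs (DecTotalOrder.totalOrder byWeight) (sort-↗ solutions)
    distinct : AllPairs (λ s t → proj₁ s ≢ proj₁ t) sorted
    distinct = AllPairs.map⁻ (Permutationₛ.Unique-resp-↭ (setoid (EdgeSet m))
                 (↭⇒↭ₛ (↭-map⁺ proj₁ (↭-sym (sort-↭ solutions))))
                 (subst Unique (sym (map-proj₁-toList L-solutions)) L-unique))

theorem4p2 : ∃[ c ] (∀ {n m} (G : Graph n m) (X : Subset n) (ω : Fin m → ℕ)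
    → (∀ (γ : Conf X) S S' → InMin ω G γ S → InMin ω G γ S' → S ≡ S')
    → (L : List (EdgeSet m)) → Unique L
    → All (λ S → ∃[ γ ] InMin ω G {X} γ S) L
    → length L ≤ 2 ^ (c * ∣ X ∣))
theorem4p2 = 3 , λ G X ω unique-min → Bound.bound G X ω unique-min
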